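{- For any connected graph $G$ of order $n\geq 2$, $$\gamma_t(M(G\circ K_1))=n+\gamma(M(G)).$$
   Context: All graphs are finite and simple. The corona $G\circ K_1$ is the graph of order $2|V(G)|$ obtained from $G$ by adding, for each vertex $v$ of $G$, a new vertex adjacent only to $v$ (a pendant edge at each vertex). A dominating set of a graph $H$ is a set $S\subseteq V(H)$ such that every vertex of $H$ is in $S$ or has a neighbor in $S$; $\gamma(H)$ is the minimum cardinality of a dominating set. For a graph $H$ with no isolated vertices, a total dominating set of $H$ is a set $S\subseteq V(H)$ such that every vertex of $H$ has at least one neighbor in $S$; $\gamma_t(H)$ is the minimum cardinality of a total dominating set. The middle graph $M(G)$ of a graph $G$ has vertex set $V(G)\cup E(G)$ (disjoint union), and two of its vertices $x,y$ are adjacent exactly when either $x,y\in E(G)$ are edges of $G$ sharing a common endpoint, or $x\in V(G)$, $y\in E(G)$ and $x$ is an endpoint of $y$ (no two elements of $V(G)$ are adjacent in $M(G)$). -}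

module Defs where

open import Data.Nat using (ℕ; _≤_; _<_)
open import Data.Fin using (Fin; splitAt; toℕ; _≟_)
open import Data.Bool using (Bool; true; false; T)
open import Data.Sum using (_⊎_; inj₁; inj₂)
open import Data.Product using (Σ; ∃; ∃-syntax; _×_; _,_)
open import Data.Empty using (⊥)
open import Data.List using (List; length)
open import Data.List.Membership.Propositional using (_∈_)
open import Data.List.Relation.Unary.Unique.Propositional using (Unique)
open import Relation.Nullary using (¬_; yes; no)
open import Relation.Nullary.Decidable using (⌊_⌋)
open import Relation.Binary.PropositionalEquality using (_≡_; _≢_; refl; sym)

record SimpleGraph (n : ℕ) : Set where
  field
    adj     : Fin n → Fin n → Bool
    adj-sym : ∀ i j → adj i j ≡ adj j i
    loopless : ∀ i → adj i i ≡ false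
open SimpleGraph public

data Reach {n : ℕ} (G : SimpleGraph n) : Fin n → Fin n → Set where
  here : ∀ {i} → Reach G i i
  step : ∀ {i j k} → T (adj G i j) → Reach G j k → Reach G i k

Connected : ∀ {n} → SimpleGraph n → Set
Connected G = ∀ i j → Reach G i j

-- Edges of G: unordered pairs {u,v}, represented canonically with u < v
record Edge {n : ℕ} (G : SimpleGraph n) : Set where
  constructor edge
  field
    u   : Fin n
    v   : Fin n
    u<v : toℕ u < toℕ v
    uv  : T (adj G u v)
open Edge public

-- Corona G ∘ K₁ on Fin (n + n): vertex i (via inj₁) is the original
-- vertex i, vertex n+i (via inj₂) is the new pendant vertex attached to i.

eqb : ∀ {n} → Fin n → Fin n → Bool
eqb i j = ⌊ i ≟ j ⌋

eqb-sym : ∀ {n} (i j : Fin n) → eqb i j ≡ eqb j i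
eqb-sym i j with i ≟ j | j ≟ i
... | yes _ | yes _ = refl
... | no _  | no _  = refl
... | yes p | no ¬q = Data.Empty.⊥-elim (¬q (sym p))
  where import Data.Empty
... | no ¬p | yes q = Data.Empty.⊥-elim (¬p (sym q))
  where import Data.Empty

coronaAdj′ : ∀ {n} → SimpleGraph n → Fin n ⊎ Fin n → Fin n ⊎ Fin n → Bool
coronaAdj′ G (inj₁ i) (inj₁ j) = adj G i j
coronaAdj′ G (inj₁ i) (inj₂ j) = eqb i j
coronaAdj′ G (inj₂ i) (inj₁ j) = eqb i j
coronaAdj′ G (inj₂ i) (inj₂ j) = false

coronaAdj′-sym : ∀ {n} (G : SimpleGraph n) x y → coronaAdj′ G x y ≡ coronaAdj′ G y x
coronaAdj′-sym G (inj₁ i) (inj₁ j) = adj-sym G i j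
coronaAdj′-sym G (inj₁ i) (inj₂ j) = eqb-sym i j
coronaAdj′-sym G (inj₂ i) (inj₁ j) = eqb-sym i j
coronaAdj′-sym G (inj₂ i) (inj₂ j) = refl

coronaAdj′-irr : ∀ {n} (G : SimpleGraph n) x → coronaAdj′ G x x ≡ false
coronaAdj′-irr G (inj₁ i) = loopless G i
coronaAdj′-irr G (inj₂ i) = refl

corona : ∀ {n} → SimpleGraph n → SimpleGraph (n Data.Nat.+ n)
corona {n} G = record
  { adj      = λ x y → coronaAdj′ G (splitAt n x) (splitAt n y)
  ; adj-sym  = λ x y → coronaAdj′-sym G (splitAt n x) (splitAt n y)
  ; loopless = λ x → coronaAdj′-irr G (splitAt n x)
  }
  where import Data.Nat

record Graph : Set₁ where
  field
    V   : Set
    Adj : V → V → Set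
open Graph public

IsEnd : ∀ {n} {G : SimpleGraph n} → Fin n → Edge G → Set
IsEnd x e = x ≡ u e ⊎ x ≡ v e

ShareEnd : ∀ {n} {G : SimpleGraph n} → Edge G → Edge G → Set
ShareEnd {n} e f = Σ (Fin n) λ x → IsEnd x e × IsEnd x f

MAdj : ∀ {n} (G : SimpleGraph n) → Fin n ⊎ Edge G → Fin n ⊎ Edge G → Set
MAdj G (inj₁ x) (inj₁ y) = ⊥
MAdj G (inj₁ x) (inj₂ e) = IsEnd x e
MAdj G (inj₂ e) (inj₁ x) = IsEnd x e
MAdj G (inj₂ e) (inj₂ f) = e ≢ f × ShareEnd e f

middle : ∀ {n} → SimpleGraph n → Graph
middle G = record { V = Fin _ ⊎ Edge G ; Adj = MAdj G }

-- Domination. A vertex subset is a duplicate-free list; its cardinality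
-- is its length.

IsDominating : (H : Graph) → List (V H) → Set
IsDominating H S = ∀ x → x ∈ S ⊎ (∃[ y ] (y ∈ S × Adj H x y))

IsTotalDominating : (H : Graph) → List (V H) → Set
IsTotalDominating H S = ∀ x → ∃[ y ] (y ∈ S × Adj H x y)

IsDominationNumber : (H : Graph) → ℕ → Set
IsDominationNumber H k =
  (∃[ S ] (Unique S × IsDominating H S × length S ≡ k)) ×
  (∀ S → Unique S → IsDominating H S → k ≤ length S)

IsTotalDominationNumber : (H : Graph) → ℕ → Set
IsTotalDominationNumber H k =
  (∃[ S ] (Unique S × IsTotalDominating H S × length S ≡ k)) ×
  (∀ S → Unique S → IsTotalDominating H S → k ≤ length S)

-- A total dominating set S of M(G ∘ K₁) contains every pendant edge {v, v′}, since that edge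
-- is the only neighbour of the pendant vertex v′. Each pendant edge {v, v′} in turn needs a
-- neighbour in S, which is v, v′ or an edge of G at v; projecting these elements to M(G)
-- yields a set meeting every vertex of G or one of its edges, i.e. a dominating set of M(G).
-- Hence |S| ≥ n + γ(M(G)). Conversely the n pendant edges together with a dominating set
-- of M(G), lifted to the corona, form a total dominating set.
module Submission where

open import Defs
open import Data.Nat using (ℕ; _≤_; _<_; _+_; z≤n; s≤s)
open import Data.Nat.Properties
  using (<-irrelevant; <-asym; m≤m+n; ≤-trans; +-monoʳ-≤; module ≤-Reasoning)
open import Data.Fin using (Fin; splitAt; toℕ; _↑ˡ_; _↑ʳ_) renaming (_≟_ to _≟ᶠ_)
open import Data.Fin.Properties
  using (toℕ-↑ˡ; toℕ-↑ʳ; toℕ<n; ↑ˡ-injective;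
         splitAt-↑ˡ; splitAt-↑ʳ; splitAt⁻¹-↑ˡ; splitAt⁻¹-↑ʳ)
open import Data.Bool using (T)
open import Data.Bool.Properties using (T-irrelevant)
open import Data.Sum using (_⊎_; inj₁; inj₂; reduce) renaming (map to ⊎-map)
open import Data.Sum.Properties using (≡-dec; inj₁-injective; inj₂-injective)
open import Data.Product using (∃-syntax; Σ-syntax; _×_; _,_; uncurry)
open import Data.Empty using (⊥-elim)
open import Data.List using (List; []; _∷_; length; map; filter; _++_; tabulate; deduplicate)
open import Data.List.Properties using (length-map; length-++; length-tabulate; filter-notAll)
open import Data.List.Membership.Propositional using (_∈_)
open import Data.List.Membership.Propositional.Properties
  using (∈-map⁺; ∈-map⁻; ∈-tabulate⁺; ∈-tabulate⁻; ∈-++⁺ˡ; ∈-++⁺ʳ; ∈-++⁻; ∈-filter⁺;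
         ∈-deduplicate⁺; ∈-deduplicate⁻)
open import Data.List.Relation.Binary.Subset.Propositional using (_⊆_)
open import Data.List.Relation.Unary.Any as Any using (Any; here; there)
open import Data.List.Relation.Unary.All as All using ()
open import Data.List.Relation.Unary.AllPairs using (_∷_)
open import Data.List.Relation.Unary.Unique.Propositional using (Unique)
import Data.List.Relation.Unary.Unique.Propositional.Properties as Unique
open import Data.List.Relation.Unary.Unique.DecPropositional.Properties using (deduplicate-!)
open import Function using (_∘_)
open import Relation.Nullary using (¬_; ¬?; map′; yes; no)
open import Relation.Nullary.Decidable using (fromWitness; toWitness; _×-dec_)
open import Relation.Unary using (Decidable)
open import Relation.Binary.Definitions using (DecidableEquality)
open import Relation.Binary.PropositionalEquality
  using (_≡_; _≢_; refl; sym; trans; cong; cong₂; subst; subst₂)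

module _ {A : Set} (_≟_ : DecidableEquality A) where

  Unique-⊆⇒length≤ : ∀ {xs ys : List A} → Unique xs → xs ⊆ ys → length xs ≤ length ys
  Unique-⊆⇒length≤ {[]}     _            _      = z≤n
  Unique-⊆⇒length≤ {x ∷ xs} {ys} (x∉xs ∷ !xs) xs⊆ys =
    ≤-trans (s≤s (Unique-⊆⇒length≤ !xs xs⊆ys-x)) (filter-notAll x≢? ys x∈ys)
    where
      x≢? : Decidable (x ≢_)
      x≢? y = ¬? (x ≟ y)
      x∈ys : Any (λ y → ¬ x ≢ y) ys
      x∈ys = Any.map (λ x≡y x≢y → x≢y x≡y) (xs⊆ys (here refl))
      xs⊆ys-x : xs ⊆ filter x≢? ys
      xs⊆ys-x z∈xs = ∈-filter⁺ x≢? (xs⊆ys (there z∈xs)) (All.lookup x∉xs z∈xs)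

rights : {A B : Set} → List (A ⊎ B) → List B
rights []            = []
rights (inj₁ _ ∷ xs) = rights xs
rights (inj₂ b ∷ xs) = b ∷ rights xs

∈-rights⁺ : {A B : Set} {b : B} {xs : List (A ⊎ B)} → inj₂ b ∈ xs → b ∈ rights xs
∈-rights⁺ {xs = inj₂ _ ∷ _} (here refl) = here refl
∈-rights⁺ {xs = inj₁ _ ∷ _} (there p)   = ∈-rights⁺ p
∈-rights⁺ {xs = inj₂ _ ∷ _} (there p)   = there (∈-rights⁺ p)

∈-rights⁻ : {A B : Set} {b : B} (xs : List (A ⊎ B)) → b ∈ rights xs → inj₂ b ∈ xs
∈-rights⁻ (inj₁ _ ∷ xs) p         = there (∈-rights⁻ xs p)
∈-rights⁻ (inj₂ _ ∷ xs) (here eq) = here (cong inj₂ eq)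
∈-rights⁻ (inj₂ _ ∷ xs) (there p) = there (∈-rights⁻ xs p)

module _ {n : ℕ} {G : SimpleGraph n} where

  Edge-≡ : {e f : Edge G} → u e ≡ u f → v e ≡ v f → e ≡ f
  Edge-≡ {edge a b p q} {edge _ _ p′ q′} refl refl =
    cong₂ (edge a b) (<-irrelevant p p′) (T-irrelevant q q′)

  _≟ᴱ_ : DecidableEquality (Edge G)
  e ≟ᴱ f = map′ (uncurry Edge-≡) (λ { refl → refl , refl })
                ((u e ≟ᶠ u f) ×-dec (v e ≟ᶠ v f))

  _≟ᴹ_ : DecidableEquality (V (middle G))
  _≟ᴹ_ = ≡-dec _≟ᶠ_ _≟ᴱ_

  CoversVertices : List (V (middle G)) → Set
  CoversVertices D = ∀ i → inj₁ i ∈ D ⊎ ∃[ e ] (inj₂ e ∈ D × IsEnd i e)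

  CoversVertices-⊆ : ∀ {D D′} → D ⊆ D′ → CoversVertices D → CoversVertices D′
  CoversVertices-⊆ D⊆D′ cover i with cover i
  ... | inj₁ i∈D           = inj₁ (D⊆D′ i∈D)
  ... | inj₂ (e , e∈D , i∈e) = inj₂ (e , D⊆D′ e∈D , i∈e)

  dominating⇒coversVertices : ∀ {D} → IsDominating (middle G) D → CoversVertices D
  dominating⇒coversVertices dom i with dom (inj₁ i)
  ... | inj₁ i∈D                   = inj₁ i∈D
  ... | inj₂ (inj₂ e , e∈D , i∈e) = inj₂ (e , e∈D , i∈e)

  -- An edge e is dominated by whatever covers its endpoint u e.
  coversVertices⇒dominating : ∀ {D} → CoversVertices D → IsDominating (middle G) D
  coversVertices⇒dominating cover (inj₁ i) with cover i
  ... | inj₁ i∈D             = inj₁ i∈D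
  ... | inj₂ (e , e∈D , i∈e) = inj₂ (inj₂ e , e∈D , i∈e)
  coversVertices⇒dominating cover (inj₂ e) with cover (u e)
  ... | inj₁ ue∈D = inj₂ (inj₁ (u e) , ue∈D , inj₁ refl)
  ... | inj₂ (f , f∈D , ue∈f) with e ≟ᴱ f
  ...   | yes refl = inj₁ f∈D
  ...   | no e≢f   = inj₂ (inj₂ f , f∈D , e≢f , u e , inj₁ refl , ue∈f)

module Corona {n : ℕ} (G : SimpleGraph n) where

  base : Fin (n + n) → Fin n
  base x = reduce (splitAt n x)

  base-↑ˡ : ∀ i → base (i ↑ˡ n) ≡ i
  base-↑ˡ i = cong reduce (splitAt-↑ˡ n i n)

  base-↑ʳ : ∀ i → base (n ↑ʳ i) ≡ i
  base-↑ʳ i = cong reduce (splitAt-↑ʳ n n i)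

  ↑ʳ≢↑ˡ : ∀ i j → n ↑ʳ i ≢ j ↑ˡ n
  ↑ʳ≢↑ˡ i j eq
    with () ← trans (sym (splitAt-↑ʳ n n i)) (trans (cong (splitAt n) eq) (splitAt-↑ˡ n j n))

  ↑ˡ<↑ʳ : ∀ (i j : Fin n) → toℕ (i ↑ˡ n) < toℕ (n ↑ʳ j)
  ↑ˡ<↑ʳ i j = begin-strict
    toℕ (i ↑ˡ n)  ≡⟨ toℕ-↑ˡ i n ⟩
    toℕ i         <⟨ toℕ<n i ⟩
    n             ≤⟨ m≤m+n n (toℕ j) ⟩
    n + toℕ j     ≡⟨ toℕ-↑ʳ n j ⟨
    toℕ (n ↑ʳ j)  ∎
    where open ≤-Reasoning

  adj-corona⁺ : ∀ {x y a b} → splitAt n x ≡ a → splitAt n y ≡ b →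
                T (coronaAdj′ G a b) → T (adj (corona G) x y)
  adj-corona⁺ refl refl x~y = x~y

  adj-corona⁻ : ∀ {x y} → T (adj (corona G) x y) → T (coronaAdj′ G (splitAt n x) (splitAt n y))
  adj-corona⁻ x~y = x~y

  pendantEdge : Fin n → Edge (corona G)
  pendantEdge i = edge (i ↑ˡ n) (n ↑ʳ i) (↑ˡ<↑ʳ i i)
    (adj-corona⁺ (splitAt-↑ˡ n i n) (splitAt-↑ʳ n n i) (fromWitness refl))

  liftEdge : Edge G → Edge (corona G)
  liftEdge e = edge (u e ↑ˡ n) (v e ↑ˡ n)
    (subst₂ _<_ (sym (toℕ-↑ˡ (u e) n)) (sym (toℕ-↑ˡ (v e) n)) (u<v e))
    (adj-corona⁺ (splitAt-↑ˡ n (u e) n) (splitAt-↑ˡ n (v e) n) (uv e))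

  liftᴹ : V (middle G) → V (middle (corona G))
  liftᴹ = ⊎-map (_↑ˡ n) liftEdge

  pendantEdge-injective : ∀ {i j} → pendantEdge i ≡ pendantEdge j → i ≡ j
  pendantEdge-injective eq = ↑ˡ-injective n _ _ (cong u eq)

  liftEdge-injective : ∀ {e f} → liftEdge e ≡ liftEdge f → e ≡ f
  liftEdge-injective eq = Edge-≡ (↑ˡ-injective n _ _ (cong u eq)) (↑ˡ-injective n _ _ (cong v eq))

  liftᴹ-injective : ∀ {x y} → liftᴹ x ≡ liftᴹ y → x ≡ y
  liftᴹ-injective {inj₁ _} {inj₁ _} eq = cong inj₁ (↑ˡ-injective n _ _ (inj₁-injective eq))
  liftᴹ-injective {inj₂ _} {inj₂ _} eq = cong inj₂ (liftEdge-injective (inj₂-injective eq))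

  pendantEdge≢liftEdge : ∀ i e → pendantEdge i ≢ liftEdge e
  pendantEdge≢liftEdge i e eq = ↑ʳ≢↑ˡ i (v e) (cong v eq)

  -- Edges are stored with u < v, which rules out a pendant vertex followed by an original one.
  coronaEdge-ends : ∀ x y → toℕ x < toℕ y → T (coronaAdj′ G (splitAt n x) (splitAt n y)) →
                    (∃[ i ] (x ≡ i ↑ˡ n × y ≡ n ↑ʳ i)) ⊎
                    (Σ[ e ∈ Edge G ] (x ≡ u e ↑ˡ n × y ≡ v e ↑ˡ n))
  coronaEdge-ends x y x<y x~y with splitAt n x in sx | splitAt n y in sy
  ... | inj₁ i | inj₁ j
    with refl ← splitAt⁻¹-↑ˡ sx | refl ← splitAt⁻¹-↑ˡ sy =
      inj₂ (edge i j (subst₂ _<_ (toℕ-↑ˡ i n) (toℕ-↑ˡ j n) x<y) x~y , refl , refl)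
  ... | inj₁ i | inj₂ j
    with refl ← splitAt⁻¹-↑ˡ sx | refl ← splitAt⁻¹-↑ʳ sy | refl ← toWitness x~y =
      inj₁ (i , refl , refl)
  ... | inj₂ i | inj₁ j
    with refl ← splitAt⁻¹-↑ʳ sx | refl ← splitAt⁻¹-↑ˡ sy = ⊥-elim (<-asym x<y (↑ˡ<↑ʳ j i))

  coronaEdge-view : ∀ f → (∃[ i ] f ≡ pendantEdge i) ⊎ (∃[ e ] f ≡ liftEdge e)
  coronaEdge-view f with coronaEdge-ends (u f) (v f) (u<v f) (uv f)
  ... | inj₁ (i , ui , vi) = inj₁ (i , Edge-≡ ui vi)
  ... | inj₂ (e , ue , ve) = inj₂ (e , Edge-≡ ue ve)

  project : V (middle (corona G)) → Fin n ⊎ V (middle G)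
  project (inj₁ x) = inj₂ (inj₁ (base x))
  project (inj₂ f) with coronaEdge-view f
  ... | inj₁ (i , _) = inj₁ i
  ... | inj₂ (e , _) = inj₂ (inj₂ e)

  project∈ : ∀ {S y z} → y ∈ S → project y ≡ z → z ∈ map project S
  project∈ y∈S refl = ∈-map⁺ project y∈S

  project-pendantEdge : ∀ i → project (inj₂ (pendantEdge i)) ≡ inj₁ i
  project-pendantEdge i with coronaEdge-view (pendantEdge i)
  ... | inj₁ (j , eq) = cong inj₁ (sym (pendantEdge-injective eq))
  ... | inj₂ (e , eq) = ⊥-elim (pendantEdge≢liftEdge i e eq)

  IsEnd-pendantEdge-base : ∀ x → IsEnd x (pendantEdge (base x))
  IsEnd-pendantEdge-base x with splitAt n x in sx
  ... | inj₁ i = inj₁ (sym (splitAt⁻¹-↑ˡ sx))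
  ... | inj₂ i = inj₂ (sym (splitAt⁻¹-↑ʳ sx))

  IsEnd-pendantEdge⇒base : ∀ {x i} → IsEnd x (pendantEdge i) → base x ≡ i
  IsEnd-pendantEdge⇒base (inj₁ refl) = base-↑ˡ _
  IsEnd-pendantEdge⇒base (inj₂ refl) = base-↑ʳ _

  IsEnd-liftEdge⁺ : ∀ {i e} → IsEnd i e → IsEnd (i ↑ˡ n) (liftEdge e)
  IsEnd-liftEdge⁺ = ⊎-map (cong (_↑ˡ n)) (cong (_↑ˡ n))

  IsEnd-liftEdge⇒IsEnd-base : ∀ {x e} → IsEnd x (liftEdge e) → IsEnd (base x) e
  IsEnd-liftEdge⇒IsEnd-base (inj₁ refl) = inj₁ (base-↑ˡ _)
  IsEnd-liftEdge⇒IsEnd-base (inj₂ refl) = inj₂ (base-↑ˡ _)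

  ¬IsEnd-↑ʳ-liftEdge : ∀ {i e} → ¬ IsEnd (n ↑ʳ i) (liftEdge e)
  ¬IsEnd-↑ʳ-liftEdge {i} {e} (inj₁ eq) = ↑ʳ≢↑ˡ i (u e) eq
  ¬IsEnd-↑ʳ-liftEdge {i} {e} (inj₂ eq) = ↑ʳ≢↑ˡ i (v e) eq

  pendantVertex-neighbour : ∀ i y → Adj (middle (corona G)) (inj₁ (n ↑ʳ i)) y →
                            y ≡ inj₂ (pendantEdge i)
  pendantVertex-neighbour i (inj₂ f) i∈f with coronaEdge-view f
  ... | inj₁ (j , refl) =
    cong (inj₂ ∘ pendantEdge) (trans (sym (IsEnd-pendantEdge⇒base i∈f)) (base-↑ʳ i))
  ... | inj₂ (e , refl) = ⊥-elim (¬IsEnd-↑ʳ-liftEdge {e = e} i∈f)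

  pendantEdge-neighbour : ∀ i y → Adj (middle (corona G)) (inj₂ (pendantEdge i)) y →
                          project y ≡ inj₂ (inj₁ i) ⊎
                          ∃[ e ] (project y ≡ inj₂ (inj₂ e) × IsEnd i e)
  pendantEdge-neighbour i (inj₁ x) x∈pᵢ =
    inj₁ (cong (inj₂ ∘ inj₁) (IsEnd-pendantEdge⇒base x∈pᵢ))
  pendantEdge-neighbour i (inj₂ f) (pᵢ≢f , x , x∈pᵢ , x∈f) with coronaEdge-view f
  ... | inj₁ (j , refl) = ⊥-elim (pᵢ≢f (cong pendantEdge
          (trans (sym (IsEnd-pendantEdge⇒base x∈pᵢ)) (IsEnd-pendantEdge⇒base x∈f))))
  ... | inj₂ (e , refl) = inj₂ (e , refl , subst (λ z → IsEnd {G = G} z e)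
          (IsEnd-pendantEdge⇒base {x} x∈pᵢ) (IsEnd-liftEdge⇒IsEnd-base {x} {e} x∈f))

  pendantEdges : List (V (middle (corona G)))
  pendantEdges = tabulate (inj₂ ∘ pendantEdge)

  withPendantEdges : List (V (middle G)) → List (V (middle (corona G)))
  withPendantEdges D = pendantEdges ++ map liftᴹ D

  pendantEdge∈withPendantEdges : ∀ D i → inj₂ (pendantEdge i) ∈ withPendantEdges D
  pendantEdge∈withPendantEdges D i = ∈-++⁺ˡ (∈-tabulate⁺ i)

  lift∈withPendantEdges : ∀ {D x} → x ∈ D → liftᴹ x ∈ withPendantEdges D
  lift∈withPendantEdges x∈D = ∈-++⁺ʳ pendantEdges (∈-map⁺ liftᴹ x∈D)

  length-withPendantEdges : ∀ D → length (withPendantEdges D) ≡ n + length D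
  length-withPendantEdges D = trans (length-++ pendantEdges)
    (cong₂ _+_ (length-tabulate (inj₂ ∘ pendantEdge)) (length-map liftᴹ D))

  withPendantEdges-unique : ∀ {D} → Unique D → Unique (withPendantEdges D)
  withPendantEdges-unique !D =
    Unique.++⁺ (Unique.tabulate⁺ (pendantEdge-injective ∘ inj₂-injective))
               (Unique.map⁺ liftᴹ-injective !D)
               disjoint
    where
      disjoint : ∀ {y} → ¬ (y ∈ pendantEdges × y ∈ map liftᴹ _)
      disjoint (y∈pendants , y∈lift) with ∈-tabulate⁻ y∈pendants | ∈-map⁻ liftᴹ y∈lift
      ... | i , refl | inj₂ e , _ , eq = pendantEdge≢liftEdge i e (inj₂-injective eq)

  withPendantEdges-totalDominating : ∀ {D} → CoversVertices D →
                                     IsTotalDominating (middle (corona G)) (withPendantEdges D)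
  withPendantEdges-totalDominating {D} cover (inj₁ x) =
    inj₂ (pendantEdge (base x)) , pendantEdge∈withPendantEdges D (base x) , IsEnd-pendantEdge-base x
  withPendantEdges-totalDominating {D} cover (inj₂ f) with coronaEdge-view f
  ... | inj₂ (e , refl) =
    inj₂ (pendantEdge (u e)) , pendantEdge∈withPendantEdges D (u e) ,
    pendantEdge≢liftEdge (u e) e ∘ sym , u e ↑ˡ n , inj₁ refl , inj₁ refl
  ... | inj₁ (i , refl) with cover i
  ...   | inj₁ i∈D = inj₁ (i ↑ˡ n) , lift∈withPendantEdges i∈D , inj₁ refl
  ...   | inj₂ (e , e∈D , i∈e) =
    inj₂ (liftEdge e) , lift∈withPendantEdges e∈D ,
    pendantEdge≢liftEdge i e , i ↑ˡ n , inj₁ refl , IsEnd-liftEdge⁺ {e = e} i∈e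

  totalDominating⇒pendantEdge∈ : ∀ {S} → IsTotalDominating (middle (corona G)) S →
                                 ∀ i → inj₂ (pendantEdge i) ∈ S
  totalDominating⇒pendantEdge∈ {S} tdom i with tdom (inj₁ (n ↑ʳ i))
  ... | y , y∈S , x~y = subst (_∈ S) (pendantVertex-neighbour i y x~y) y∈S

  totalDominating⇒coversVertices : ∀ {S} → IsTotalDominating (middle (corona G)) S →
                                   CoversVertices (rights (map project S))
  totalDominating⇒coversVertices {S} tdom i
    with y , y∈S , x~y ← tdom (inj₂ (pendantEdge i))
    with pendantEdge-neighbour i y x~y
  ... | inj₁ eq             = inj₁ (∈-rights⁺ (project∈ y∈S eq))
  ... | inj₂ (e , eq , i∈e) = inj₂ (e , ∈-rights⁺ (project∈ y∈S eq) , i∈e)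

  -- S projects onto all n pendant indices together with a dominating set of M(G), and
  -- distinct elements of that target have distinct preimages in S.
  totalDominating⇒length≥ :
    ∀ k → (∀ D → Unique D → IsDominating (middle G) D → k ≤ length D) →
    ∀ {S} → IsTotalDominating (middle (corona G)) S → n + k ≤ length S
  totalDominating⇒length≥ k minimal {S} tdom = begin
    n + k                   ≤⟨ +-monoʳ-≤ n k≤|D| ⟩
    n + length D            ≡⟨ length-needed ⟨
    length needed           ≤⟨ Unique-⊆⇒length≤ (≡-dec _≟ᶠ_ _≟ᴹ_) needed-unique needed⊆P ⟩
    length (map project S)  ≡⟨ length-map project S ⟩
    length S                ∎
    where
      open ≤-Reasoning
      P : List (Fin n ⊎ V (middle G))
      P = map project S

      D : List (V (middle G))
      D = deduplicate _≟ᴹ_ (rights P)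

      indices : List (Fin n ⊎ V (middle G))
      indices = tabulate inj₁

      needed : List (Fin n ⊎ V (middle G))
      needed = indices ++ map inj₂ D

      k≤|D| : k ≤ length D
      k≤|D| = minimal D (deduplicate-! _≟ᴹ_ (rights P)) (coversVertices⇒dominating
                (CoversVertices-⊆ (∈-deduplicate⁺ _≟ᴹ_) (totalDominating⇒coversVertices tdom)))

      length-needed : length needed ≡ n + length D
      length-needed =
        trans (length-++ indices) (cong₂ _+_ (length-tabulate inj₁) (length-map inj₂ D))

      needed-unique : Unique needed
      needed-unique = Unique.++⁺ (Unique.tabulate⁺ inj₁-injective)
                                 (Unique.map⁺ inj₂-injective (deduplicate-! _≟ᴹ_ (rights P)))
                                 disjoint
        where
          disjoint : ∀ {y} → ¬ (y ∈ indices × y ∈ map inj₂ D)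
          disjoint (y∈indices , y∈inj₂) with ∈-tabulate⁻ {f = inj₁} y∈indices | ∈-map⁻ inj₂ y∈inj₂
          ... | _ , refl | _ , _ , ()

      needed⊆P : needed ⊆ P
      needed⊆P y∈needed with ∈-++⁻ indices y∈needed
      ... | inj₁ y∈indices with i , refl ← ∈-tabulate⁻ {f = inj₁} y∈indices =
        project∈ (totalDominating⇒pendantEdge∈ tdom i) (project-pendantEdge i)
      ... | inj₂ y∈inj₂ with d , d∈D , refl ← ∈-map⁻ inj₂ y∈inj₂ =
        ∈-rights⁻ P (∈-deduplicate⁻ _≟ᴹ_ (rights P) d∈D)

theorem4p3 : (n : ℕ) → 2 ≤ n → (G : SimpleGraph n) → Connected G →
    (k : ℕ) → IsDominationNumber (middle G) k →
    IsTotalDominationNumber (middle (corona G)) (n + k)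
theorem4p3 n _ G _ k ((D , !D , dominating , |D|≡k) , minimal) =
  ( withPendantEdges D
  , withPendantEdges-unique !D
  , withPendantEdges-totalDominating (dominating⇒coversVertices dominating)
  , trans (length-withPendantEdges D) (cong (n +_) |D|≡k) )
  , λ S _ → totalDominating⇒length≥ k minimal
  where open Corona G
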